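{- Let $\mathcal{F}$ be a 3-SAT formula with variables $x_1,\dots,x_n$ and clauses $Q_1,\dots,Q_s$, let $k\ge 1$ be an integer, and let $G_F$ be the graph constructed from $\mathcal{F}$ and $k$ as described in the context. For every variable $x_i$, there exist two different vertices $a,b\in V(C^i)$ such that every vertex of $G_F$ distinguishing $a$ and $b$ lies in $V(C^i)$. Consequently, for any $k$-metric basis $S$ of $G_F$, $|S\cap V(C^i)|\ge k$.
   Context: For a connected graph $G$, a vertex $w$ distinguishes $u,v$ if $d_G(u,w)\ne d_G(v,w)$. A set $S\subseteq V(G)$ is a $k$-metric generator if every pair of different vertices is distinguished by at least $k$ elements of $S$; a minimum-cardinality one is a $k$-metric basis, with cardinality $\dim_k(G)$. Construction of $G_F$ (each clause consists of three literals, a literal being $x_i$ or $\overline{x_i}$): (1) For every variable $x_i$ take a cycle $C^i$ of order $4\lceil k/2\rceil+2$ and let $T_i$ and $F_i$ be two diametral (antipodal) vertices of $C^i$. (2) For every clause $Q_j$ take a star $S_{1,4}$ with center $u_j$ and leaves $u_j^1,u_j^2,u_j^3,u_j^4$; if $k\ge 3$, subdivide the edge $u_ju_j^2$ so that the $u_j$–$u_j^2$ path has $\lceil k/2\rceil+1$ vertices and subdivide the edge $u_ju_j^3$ so that the $u_j$–$u_j^3$ path has $\lfloor k/2\rfloor+1$ vertices; $P(u_j^2,u_j^3)$ denotes the resulting $u_j^2$–$u_j^3$ path (through $u_j$). (3) If $x_i$ occurs as a positive literal in $Q_j$, add edges $T_iu_j^1$, $F_iu_j^1$, $F_iu_j^4$.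 (4) If $x_i$ occurs as a negative literal in $Q_j$, add edges $T_iu_j^1$, $F_iu_j^1$, $T_iu_j^4$. (5) For every $l$ such that neither $x_l$ nor $\overline{x_l}$ occurs in $Q_j$, add edges $T_lu_j^1$, $T_lu_j^4$, $F_lu_j^1$, $F_lu_j^4$. -}

module Defs where

open import Data.Nat.Base using (ℕ; zero; suc; _+_; _*_; _∸_; _≤_; ⌈_/2⌉; ⌊_/2⌋; _%_)
open import Data.Fin.Base using (Fin; toℕ)
open import Data.Bool.Base using (Bool; true; false)
open import Data.Vec.Base using (Vec)
open import Data.Vec.Membership.Propositional using () renaming (_∈_ to _∈ᵥ_)
open import Data.List.Base using (List; length)
open import Data.List.Membership.Propositional using (_∈_)
open import Data.List.Relation.Unary.All using (All)
open import Data.List.Relation.Unary.Unique.Propositional using (Unique)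
open import Data.Product.Base using (Σ; _×_; ∃)
open import Data.Sum.Base using (_⊎_)
open import Relation.Nullary using (¬_)
open import Relation.Binary.PropositionalEquality using (_≡_; _≢_)

-- General graph notions for a graph given by a vertex type V and an
-- adjacency relation Adj (assumed symmetric where used).

module GraphNotions {V : Set} (Adj : V → V → Set) where

  data Walk : V → V → ℕ → Set where
    here : ∀ {u} → Walk u u 0
    step : ∀ {u w v m} → Adj u w → Walk w v m → Walk u v (suc m)

  Dist : V → V → ℕ → Set
  Dist u v d = Walk u v d × (∀ m → Walk u v m → d ≤ m)

  Distinguishes : V → V → V → Set
  Distinguishes w a b = Σ ℕ λ d₁ → Σ ℕ λ d₂ → Dist a w d₁ × Dist b w d₂ × d₁ ≢ d₂

  AtLeast : ℕ → List V → (V → Set) → Set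
  AtLeast k S P = Σ (List V) λ D → Unique D × All (_∈ S) D × All P D × k ≤ length D

  IsKMetricGenerator : ℕ → List V → Set
  IsKMetricGenerator k S =
    Unique S × (∀ a b → a ≢ b → AtLeast k S (λ w → Distinguishes w a b))

  IsKMetricBasis : ℕ → List V → Set
  IsKMetricBasis k S =
    IsKMetricGenerator k S × (∀ S' → IsKMetricGenerator k S' → length S ≤ length S')

-- 3-SAT formulas: a literal is (variable , polarity), true = positive.

Lit : ℕ → Set
Lit n = Fin n × Bool

Clause : ℕ → Set
Clause n = Vec (Lit n) 3

Formula : ℕ → ℕ → Set
Formula n s = Vec (Clause n) s

OccursPos : ∀ {n} → Fin n → Clause n → Set
OccursPos i Q = (i Data.Product.Base., true) ∈ᵥ Q

OccursNeg : ∀ {n} → Fin n → Clause n → Set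
OccursNeg i Q = (i Data.Product.Base., false) ∈ᵥ Q

Occurs : ∀ {n} → Fin n → Clause n → Set
Occurs i Q = OccursPos i Q ⊎ OccursNeg i Q

cycOrd : ℕ → ℕ
cycOrd k = 2 + 4 * ⌈ k /2⌉

-- position of F_i on C^i (T_i is at position 0); antipodal to T_i
halfCyc : ℕ → ℕ
halfCyc k = 1 + 2 * ⌈ k /2⌉

-- number of vertices of the path P(u_j^2,u_j^3)
-- (for k ≤ 2 no subdivision: u_j^2 - u_j - u_j^3)
pathLen : ℕ → ℕ
pathLen 0 = 3
pathLen 1 = 3
pathLen 2 = 3
pathLen k@(suc (suc (suc _))) = (⌈ k /2⌉ + 1) + (⌊ k /2⌋ + 1) ∸ 1

-- On P(u_j^2,u_j^3), u_j^2 is at position 0, u_j at position ⌈k/2⌉,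
-- u_j^3 at position pathLen k ∸ 1.

data V (n s k : ℕ) : Set where
  cyc : Fin n → Fin (cycOrd k) → V n s k
  u¹  : Fin s → V n s k
  u⁴  : Fin s → V n s k
  pth : Fin s → Fin (pathLen k) → V n s k

module _ {n s : ℕ} (k : ℕ) (F : Formula n s) where

  private
    Q : Fin s → Clause n
    Q j = Data.Vec.Base.lookup F j

  IsT : Fin (cycOrd k) → Set
  IsT a = toℕ a ≡ 0

  IsF : Fin (cycOrd k) → Set
  IsF a = toℕ a ≡ halfCyc k

  data E : V n s k → V n s k → Set where
    e-cyc  : ∀ {i a b} → toℕ b ≡ suc (toℕ a) % cycOrd k → E (cyc i a) (cyc i b)
    e-pth  : ∀ {j a b} → toℕ b ≡ suc (toℕ a) → E (pth j a) (pth j b)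
    e-u¹   : ∀ {j c} → toℕ c ≡ ⌈ k /2⌉ → E (u¹ j) (pth j c)
    e-u⁴   : ∀ {j c} → toℕ c ≡ ⌈ k /2⌉ → E (u⁴ j) (pth j c)
    -- T_i u_j^1 and F_i u_j^1 (present in all cases (3),(4),(5))
    e-T¹   : ∀ {i a j} → IsT a → E (cyc i a) (u¹ j)
    e-F¹   : ∀ {i a j} → IsF a → E (cyc i a) (u¹ j)
    e-F⁴p  : ∀ {i a j} → IsF a → OccursPos i (Q j) → E (cyc i a) (u⁴ j)
    e-F⁴n  : ∀ {i a j} → IsF a → ¬ Occurs i (Q j) → E (cyc i a) (u⁴ j)
    e-T⁴n  : ∀ {i a j} → IsT a → OccursNeg i (Q j) → E (cyc i a) (u⁴ j)
    e-T⁴o  : ∀ {i a j} → IsT a → ¬ Occurs i (Q j) → E (cyc i a) (u⁴ j)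

  Adj : V n s k → V n s k → Set
  Adj u v = E u v ⊎ E v u

InCycle : ∀ {n s k} → Fin n → V n s k → Set
InCycle {k = k} i v = Σ (Fin (cycOrd k)) λ p → v ≡ cyc i p

-- Reflecting the cycle C^i in the axis through T_i and F_i, and fixing every
-- other vertex, is an automorphism of G_F: the only edges between C^i and the
-- rest of the graph leave from T_i and F_i. An automorphism preserves
-- distances, so a vertex it fixes cannot distinguish a vertex from its image.
-- Taking for a, b the two neighbours of T_i on C^i, every vertex distinguishing
-- them lies on C^i, and the k distinguishers that a k-metric generator must
-- contain for the pair a, b all lie in S ∩ V(C^i).
module Submission where

open import Defs
open import Data.Nat.Base using (ℕ; zero; suc; _+_; _*_; _∸_; _%_; _<_; _≤_; s≤s; z≤n; NonZero; ⌈_/2⌉)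
open import Data.Nat.Properties
  using (≤-antisym; <⇒≤; ≤-pred; m≤n⇒m<n∨m≡n; m∸n≤m; +-∸-assoc; m∸[m∸n]≡n; m+n∸m≡n; m+n∸n≡m; m<m+n; ⌈n/2⌉-mono; +-suc; *-distribʳ-+)
open import Data.Nat.DivMod using (n%n≡0; m%n<n; m<n⇒m%n≡m)
open import Data.Fin.Base using (Fin; toℕ; fromℕ<) renaming (zero to fzero; suc to fsuc)
open import Data.Fin.Properties using (toℕ-fromℕ<; toℕ-injective; toℕ<n) renaming (_≟_ to _≟ᶠ_)
open import Data.List.Base using (List)
import Data.List.Relation.Unary.All as All
open import Data.Product.Base using (Σ; _×_; _,_)
open import Data.Sum.Base using (_⊎_; inj₁; inj₂; swap)
open import Data.Empty using (⊥-elim)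
open import Relation.Nullary using (¬_; yes; no)
open import Relation.Binary.PropositionalEquality
  using (_≡_; _≢_; refl; sym; trans; cong; subst₂; module ≡-Reasoning)
open ≡-Reasoning

module _ {V : Set} (Adj : V → V → Set) where
  open GraphNotions Adj

  Dist-unique : ∀ {u v d d′} → Dist u v d → Dist u v d′ → d ≡ d′
  Dist-unique (w , minimal) (w′ , minimal′) = ≤-antisym (minimal _ w′) (minimal′ _ w)

  AtLeast-distinguishers : ∀ {k S a b} {P : V → Set} → IsKMetricGenerator k S → a ≢ b →
                           (∀ w → Distinguishes w a b → P w) → AtLeast k S P
  AtLeast-distinguishers (_ , generates) a≢b dist⇒P with generates _ _ a≢b
  ... | D , unique , D⊆S , allDist , k≤|D| = D , unique , D⊆S , All.map (dist⇒P _) allDist , k≤|D|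

  module Involution (σ : V → V) (σ-involutive : ∀ v → σ (σ v) ≡ v)
                    (σ-adj : ∀ {u v} → Adj u v → Adj (σ u) (σ v)) where

    Walk-map : ∀ {u v d} → Walk u v d → Walk (σ u) (σ v) d
    Walk-map here       = here
    Walk-map (step e w) = step (σ-adj e) (Walk-map w)

    Dist-map : ∀ {u v d} → Dist u v d → Dist (σ u) (σ v) d
    Dist-map (w , minimal) = Walk-map w , λ m w′ →
      minimal m (subst₂ (λ x y → Walk x y m) (σ-involutive _) (σ-involutive _) (Walk-map w′))

    fixed-¬Distinguishes : ∀ {w a b} → σ a ≡ b → σ w ≡ w → ¬ Distinguishes w a b
    fixed-¬Distinguishes σa≡b σw≡w (d₁ , d₂ , dist-a , dist-b , d₁≢d₂) =
      d₁≢d₂ (Dist-unique (subst₂ (λ x y → Dist x y d₁) σa≡b σw≡w (Dist-map dist-a)) dist-b)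

-- The reflection p ↦ -p of ℤ/(suc m), on representatives 0 … m.
reflectℕ : ℕ → ℕ → ℕ
reflectℕ m p = (suc m ∸ p) % suc m

reflectℕ-zero : ∀ m → reflectℕ m 0 ≡ 0
reflectℕ-zero m = n%n≡0 (suc m)

reflectℕ-suc : ∀ m q → reflectℕ m (suc q) ≡ m ∸ q
reflectℕ-suc m q = m<n⇒m%n≡m (s≤s (m∸n≤m m q))

reflectℕ-involutive : ∀ m p → p < suc m → reflectℕ m (reflectℕ m p) ≡ p
reflectℕ-involutive m zero _ = trans (cong (reflectℕ m) (reflectℕ-zero m)) (reflectℕ-zero m)
reflectℕ-involutive m (suc q) (s≤s q<m) = begin
  reflectℕ m (reflectℕ m (suc q)) ≡⟨ cong (reflectℕ m) (reflectℕ-suc m q) ⟩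
  reflectℕ m (m ∸ q)              ≡⟨ cong (reflectℕ m) (+-∸-assoc 1 q<m) ⟩
  reflectℕ m (suc (m ∸ suc q))    ≡⟨ reflectℕ-suc m (m ∸ suc q) ⟩
  m ∸ (m ∸ suc q)                 ≡⟨ m∸[m∸n]≡n q<m ⟩
  suc q                           ∎

reflectℕ-reverses-successor : ∀ m a b → a < suc m → b ≡ suc a % suc m →
                              reflectℕ m a ≡ suc (reflectℕ m b) % suc m
reflectℕ-reverses-successor m a b a≤m b≡a+1 with m≤n⇒m<n∨m≡n (≤-pred a≤m)
... | inj₁ a<m = begin
  (suc m ∸ a) % suc m              ≡⟨ cong (_% suc m) (+-∸-assoc 1 (<⇒≤ a<m)) ⟩
  suc (m ∸ a) % suc m              ≡⟨ cong (λ x → suc x % suc m) (sym (reflectℕ-suc m a)) ⟩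
  suc (reflectℕ m (suc a)) % suc m ≡⟨ cong (λ x → suc (reflectℕ m x) % suc m)
                                         (sym (trans b≡a+1 (m<n⇒m%n≡m (s≤s a<m)))) ⟩
  suc (reflectℕ m b) % suc m       ∎
... | inj₂ refl = begin
  (suc a ∸ a) % suc a              ≡⟨ cong (_% suc a) (m+n∸n≡m 1 a) ⟩
  1 % suc a                        ≡⟨ cong (λ x → suc x % suc a) (sym (reflectℕ-zero a)) ⟩
  suc (reflectℕ a 0) % suc a       ≡⟨ cong (λ x → suc (reflectℕ a x) % suc a)
                                         (sym (trans b≡a+1 (n%n≡0 (suc a)))) ⟩
  suc (reflectℕ a b) % suc a       ∎

antipode-fixed : ∀ N h .{{_ : NonZero N}} → N ≡ h + h → 0 < h → (N ∸ h) % N ≡ h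
antipode-fixed .(h + h) h refl 0<h rewrite m+n∸m≡n h h = m<n⇒m%n≡m (m<m+n h 0<h)

reflect : ∀ {m} → Fin (suc m) → Fin (suc m)
reflect {m} p = fromℕ< (m%n<n (suc m ∸ toℕ p) (suc m))

toℕ-reflect : ∀ {m} (p : Fin (suc m)) → toℕ (reflect p) ≡ reflectℕ m (toℕ p)
toℕ-reflect {m} p = toℕ-fromℕ< (m%n<n (suc m ∸ toℕ p) (suc m))

toℕ-reflect-one : ∀ {m} → toℕ (reflect {suc m} (fsuc fzero)) ≡ suc m
toℕ-reflect-one {m} = trans (toℕ-reflect (fsuc fzero)) (reflectℕ-suc (suc m) 0)

reflect-involutive : ∀ {m} (p : Fin (suc m)) → reflect (reflect p) ≡ p
reflect-involutive {m} p = toℕ-injective (begin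
  toℕ (reflect (reflect p))      ≡⟨ toℕ-reflect (reflect p) ⟩
  reflectℕ m (toℕ (reflect p))   ≡⟨ cong (reflectℕ m) (toℕ-reflect p) ⟩
  reflectℕ m (reflectℕ m (toℕ p)) ≡⟨ reflectℕ-involutive m (toℕ p) (toℕ<n p) ⟩
  toℕ p                          ∎)

cycOrd≡halfCyc+halfCyc : ∀ k → cycOrd k ≡ halfCyc k + halfCyc k
cycOrd≡halfCyc+halfCyc k =
  cong suc (trans (cong suc (*-distribʳ-+ c 2 2)) (sym (+-suc (2 * c) (2 * c))))
  where c = ⌈ k /2⌉

module CycleReflection {n s : ℕ} (F : Formula n s) (k : ℕ) (i : Fin n) where

  m : ℕ
  m = suc (4 * ⌈ k /2⌉)

  reflectOn : Fin n → Fin (cycOrd k) → Fin (cycOrd k)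
  reflectOn j p with j ≟ᶠ i
  ... | yes _ = reflect p
  ... | no  _ = p

  reflectOn-involutive : ∀ j p → reflectOn j (reflectOn j p) ≡ p
  reflectOn-involutive j p with j ≟ᶠ i
  ... | yes _ = reflect-involutive p
  ... | no  _ = refl

  reflectOn-IsT : ∀ j p → IsT k F p → IsT k F (reflectOn j p)
  reflectOn-IsT j p p≡0 with j ≟ᶠ i
  ... | yes _ = trans (toℕ-reflect p) (trans (cong (reflectℕ m) p≡0) (reflectℕ-zero m))
  ... | no  _ = p≡0

  reflectOn-IsF : ∀ j p → IsF k F p → IsF k F (reflectOn j p)
  reflectOn-IsF j p p≡h with j ≟ᶠ i
  ... | yes _ = trans (toℕ-reflect p) (trans (cong (reflectℕ m) p≡h)
                  (antipode-fixed (cycOrd k) (halfCyc k) (cycOrd≡halfCyc+halfCyc k) (s≤s z≤n)))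
  ... | no  _ = p≡h

  σ : V n s k → V n s k
  σ (cyc j p) = cyc j (reflectOn j p)
  σ v         = v

  σ-involutive : ∀ v → σ (σ v) ≡ v
  σ-involutive (cyc j p) = cong (cyc j) (reflectOn-involutive j p)
  σ-involutive (u¹ _)    = refl
  σ-involutive (u⁴ _)    = refl
  σ-involutive (pth _ _) = refl

  σ-cycle-edge : ∀ j a b → toℕ b ≡ suc (toℕ a) % cycOrd k → Adj k F (σ (cyc j a)) (σ (cyc j b))
  σ-cycle-edge j a b b≡a+1 with j ≟ᶠ i
  ... | yes _ = inj₂ (e-cyc (begin
    toℕ (reflect a)                          ≡⟨ toℕ-reflect a ⟩
    reflectℕ m (toℕ a)                       ≡⟨ reflectℕ-reverses-successor m (toℕ a) (toℕ b) (toℕ<n a) b≡a+1 ⟩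
    suc (reflectℕ m (toℕ b)) % cycOrd k      ≡⟨ cong (λ x → suc x % cycOrd k) (sym (toℕ-reflect b)) ⟩
    suc (toℕ (reflect b)) % cycOrd k         ∎))
  ... | no  _ = inj₁ (e-cyc b≡a+1)

  σ-edge : ∀ {u v} → E k F u v → Adj k F (σ u) (σ v)
  σ-edge (e-cyc {j} {a} {b} b≡a+1)  = σ-cycle-edge j a b b≡a+1
  σ-edge (e-pth eq)                 = inj₁ (e-pth eq)
  σ-edge (e-u¹ eq)                  = inj₁ (e-u¹ eq)
  σ-edge (e-u⁴ eq)                  = inj₁ (e-u⁴ eq)
  σ-edge (e-T¹ {j} {a} t)           = inj₁ (e-T¹ (reflectOn-IsT j a t))
  σ-edge (e-F¹ {j} {a} f)           = inj₁ (e-F¹ (reflectOn-IsF j a f))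
  σ-edge (e-F⁴p {j} {a} f occ)      = inj₁ (e-F⁴p (reflectOn-IsF j a f) occ)
  σ-edge (e-F⁴n {j} {a} f occ)      = inj₁ (e-F⁴n (reflectOn-IsF j a f) occ)
  σ-edge (e-T⁴n {j} {a} t occ)      = inj₁ (e-T⁴n (reflectOn-IsT j a t) occ)
  σ-edge (e-T⁴o {j} {a} t occ)      = inj₁ (e-T⁴o (reflectOn-IsT j a t) occ)

  σ-adj : ∀ {u v} → Adj k F u v → Adj k F (σ u) (σ v)
  σ-adj (inj₁ e) = σ-edge e
  σ-adj (inj₂ e) = swap (σ-edge e)

  σ-fixes-off-cycle : ∀ (w : V n s k) → ¬ InCycle i w → σ w ≡ w
  σ-fixes-off-cycle (cyc j p) w∉Cⁱ with j ≟ᶠ i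
  ... | yes refl = ⊥-elim (w∉Cⁱ (p , refl))
  ... | no  _    = refl
  σ-fixes-off-cycle (u¹ _)    _ = refl
  σ-fixes-off-cycle (u⁴ _)    _ = refl
  σ-fixes-off-cycle (pth _ _) _ = refl

  InCycle-dec : ∀ (w : V n s k) → InCycle i w ⊎ ¬ InCycle i w
  InCycle-dec (cyc j p) with j ≟ᶠ i
  ... | yes refl = inj₁ (p , refl)
  ... | no  j≢i  = inj₂ λ { (_ , refl) → j≢i refl }
  InCycle-dec (u¹ _)    = inj₂ λ { (_ , ()) }
  InCycle-dec (u⁴ _)    = inj₂ λ { (_ , ()) }
  InCycle-dec (pth _ _) = inj₂ λ { (_ , ()) }

  open GraphNotions (Adj k F)
  open Involution (Adj k F) σ σ-involutive σ-adj

  a b : V n s k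
  a = cyc i (fsuc fzero)
  b = cyc i (reflect (fsuc fzero))

  σa≡b : σ a ≡ b
  σa≡b with i ≟ᶠ i
  ... | yes _   = refl
  ... | no  i≢i = ⊥-elim (i≢i refl)

  a≢b : 1 ≤ k → a ≢ b
  a≢b 1≤k a≡b = 1≢1+4* (⌈n/2⌉-mono 1≤k) (trans (cong position a≡b) toℕ-reflect-one)
    where
    position : V n s k → ℕ
    position (cyc _ p) = toℕ p
    position _         = 0

    1≢1+4* : ∀ {c} → 1 ≤ c → 1 ≢ suc (4 * c)
    1≢1+4* (s≤s z≤n) ()

  distinguishers-on-cycle : ∀ (w : V n s k) → Distinguishes w a b → InCycle i w
  distinguishers-on-cycle w w-dist with InCycle-dec w
  ... | inj₁ w∈Cⁱ = w∈Cⁱ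
  ... | inj₂ w∉Cⁱ = ⊥-elim (fixed-¬Distinguishes σa≡b (σ-fixes-off-cycle w w∉Cⁱ) w-dist)

mainTheorem3 : ∀ {n s : ℕ} (F : Formula n s) (k : ℕ) → 1 ≤ k →
    let open GraphNotions (Adj k F) in
    ((i : Fin n) → Σ (V n s k) λ a → Σ (V n s k) λ b →
        InCycle i a × InCycle i b × a ≢ b ×
        (∀ w → Distinguishes w a b → InCycle i w))
    × (∀ (S : List (V n s k)) → IsKMetricBasis k S →
        (i : Fin n) → AtLeast k S (InCycle i))
mainTheorem3 F k 1≤k =
    (λ i → a i , b i , (_ , refl) , (_ , refl) , a≢b i 1≤k , distinguishers-on-cycle i)
  , λ S (generator , _) i →
      AtLeast-distinguishers (Adj k F) generator (a≢b i 1≤k) (distinguishers-on-cycle i)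
  where open CycleReflection F k
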